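{- Every composition $\beta$ that is a palindrome is $\mathcal{L}$-unique.
   Context: A composition is a finite sequence $\beta=\beta_1\cdots\beta_k$ of positive integers; its reverse is $\beta_k\cdots\beta_1$; it is a palindrome if it equals its reverse; $[\beta]^*=\{\beta,\text{reverse of }\beta\}$. $\alpha\succeq\beta$ ($\alpha$ is a coarsening of $\beta$) if $\alpha$ is obtained from $\beta$ by summing blocks of consecutive components; $\lambda(\alpha)$ is the partition obtained by sorting the components of $\alpha$ decreasingly; with commuting indeterminates $x_1,x_2,\ldots$ and $\mathbf{x}_\lambda=x_{\lambda_1}\cdots x_{\lambda_l}$, $\mathcal{L}(\beta,\mathbf{x})=\sum_{\alpha\succeq\beta}\mathbf{x}_{\lambda(\alpha)}$. A composition $\beta$ is $\mathcal{L}$-unique if the set of compositions $\alpha$ with $\mathcal{L}(\alpha,\mathbf{x})=\mathcal{L}(\beta,\mathbf{x})$ equals $[\beta]^*$. -}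

module Defs where

open import Data.Nat using (ℕ; zero; suc; _+_; _<_; _≤?_)
open import Data.List using (List; []; _∷_; _++_; map; reverse)
open import Data.List.Relation.Unary.All using (All)
open import Data.List.Relation.Binary.Permutation.Propositional using (_↭_)
open import Data.Sum using (_⊎_)
open import Data.Product using (_×_)
open import Function.Bundles using (_⇔_)
open import Relation.Nullary using (yes; no)
open import Relation.Binary.PropositionalEquality using (_≡_)

IsComposition : List ℕ → Set
IsComposition β = All (0 <_) β

IsPalindrome : List ℕ → Set
IsPalindrome β = reverse β ≡ β

-- Enumeration of all coarsenings α ⪰ β (obtained by summing blocks of
-- consecutive components): at each gap between two consecutive
-- components we either cut or merge.  For compositions (positive parts)
-- each coarsening appears exactly once.
-- coarseningsFrom a β enumerates the coarsenings of a ∷ β.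
coarseningsFrom : ℕ → List ℕ → List (List ℕ)
coarseningsFrom a []      = (a ∷ []) ∷ []
coarseningsFrom a (b ∷ β) = map (a ∷_) (coarseningsFrom b β) ++ coarseningsFrom (a + b) β

coarsenings : List ℕ → List (List ℕ)
coarsenings []      = [] ∷ []
coarsenings (a ∷ β) = coarseningsFrom a β

insertDec : ℕ → List ℕ → List ℕ
insertDec x []       = x ∷ []
insertDec x (y ∷ ys) with y ≤? x
... | yes _ = x ∷ y ∷ ys
... | no  _ = y ∷ insertDec x ys

partitionOf : List ℕ → List ℕ
partitionOf []       = []
partitionOf (x ∷ xs) = insertDec x (partitionOf xs)

-- L(β,x) = Σ_{α ⪰ β} x_{λ(α)}.  A polynomial with nonnegative integer
-- coefficients in commuting indeterminates x_1,x_2,... whose terms are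
-- monomials x_λ is represented by the multiset of the partitions λ of its
-- terms (as a list of partitions, taken up to permutation); distinct
-- partitions give distinct monomials.
L : List ℕ → List (List ℕ)
L β = map partitionOf (coarsenings β)

_≡L_ : List ℕ → List ℕ → Set
α ≡L β = L α ↭ L β

LUnique : List ℕ → Set
LUnique β = (α : List ℕ) → IsComposition α → (α ≡L β ⇔ (α ≡ β ⊎ α ≡ reverse β))

module Submission where

-- Selecting the monomials of L(β) with a given number of parts recovers two
-- invariants of a non-empty composition β of total N:
--   * its one-part monomials are just x_N, so L determines the total (and
--     whether the composition is empty at all);
--   * its two-part monomials are the x_t x_(N-t), one for each proper prefix
--     sum t of β (cut β after one of its components).
-- If β is a palindrome its set Y of prefix sums is closed under t ↦ N - t.
-- For a composition α with prefix sums X and L(α) = L(β) the multisets of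
-- pairs {t, N - t} over X and over Y agree, and counting each fibre
-- {t, N - t} shows that X and Y have the same elements; the symmetry of Y is
-- what makes the count work.  Prefix sums are strictly increasing, hence
-- determined by their set of elements, and with the total they determine
-- the composition, so α = β.

open import Defs
open import Data.Bool using (true; false)
open import Data.Nat using (ℕ; suc; _+_; _∸_; _≤_; _<_; _≤?_; _≟_; z≤n; s≤s)
open import Data.Nat.Properties
  using (≤-refl; ≤-trans; <⇒≤; <-irrefl; <-≤-trans; ≤-antisym; ≤-total; <⇒≢; m≤m+n; m<m+n;
         m+n∸m≡n; m∸[m∸n]≡n; +-assoc; +-identityʳ; +-cancelˡ-≡)
open import Data.Nat.ListAction using (sum)
open import Data.Nat.ListAction.Properties using (sum-++; sum-↭)
open import Data.List using (List; []; _∷_; _++_; map; reverse; length; filter; [_])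
open import Data.List.Properties
  using (≡-dec; ∷-injective; ∷-injectiveˡ; ∷-injectiveʳ; map-∘; length-map; filter-++;
         reverse-++; unfold-reverse)
open import Data.List.Membership.Propositional using (_∈_)
open import Data.List.Membership.Propositional.Properties
  using (∈-map⁺; ∈-map⁻; ∈-filter⁺; ∈-filter⁻)
open import Data.List.Relation.Unary.Any using (here; there)
open import Data.List.Relation.Unary.All as All using (All; []; _∷_)
open import Data.List.Relation.Unary.AllPairs as AllPairs using (AllPairs; []; _∷_)
open import Data.List.Relation.Unary.Unique.Propositional using (Unique)
import Data.List.Relation.Unary.Unique.Propositional.Properties as Unique
open import Data.List.Relation.Binary.Subset.Propositional using (_⊆_)
open import Data.List.Relation.Binary.Permutation.Propositional using (_↭_; ↭-refl; ↭-sym)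
open import Data.List.Relation.Binary.Permutation.Propositional.Properties
  using (filter-↭; ↭-length; ↭-empty-inv; ↭-singleton-inv; ↭-reverse; ∈-resp-↭)
open import Data.Sum using (_⊎_; inj₁; inj₂)
open import Data.Product using (_×_; _,_; proj₁; proj₂; ∃-syntax)
open import Data.Empty using (⊥-elim)
open import Function using (_∘_)
open import Function.Bundles using (mk⇔)
open import Relation.Nullary using (yes; no; does)
open import Relation.Unary using (Decidable)
open import Relation.Binary.Definitions using (DecidableEquality)
open import Relation.Binary.PropositionalEquality
  using (_≡_; _≢_; refl; sym; trans; cong; cong₂; subst; subst₂; module ≡-Reasoning)
open ≡-Reasoning

filter-map : ∀ {A B : Set} {P : B → Set} (P? : Decidable P) (f : A → B) (xs : List A) →
             filter P? (map f xs) ≡ map f (filter (P? ∘ f) xs)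
filter-map P? f []       = refl
filter-map P? f (x ∷ xs) with does (P? (f x))
... | true  = cong (f x ∷_) (filter-map P? f xs)
... | false = filter-map P? f xs

reverse-nonEmpty : ∀ {A : Set} (y : A) ys → ∃[ z ] ∃[ zs ] reverse (y ∷ ys) ≡ z ∷ zs
reverse-nonEmpty y ys with reverse ys | unfold-reverse y ys
... | []     | e = y , [] , e
... | z ∷ zs | e = z , zs ++ [ y ] , e

twoMembers⇒2≤length : ∀ {A : Set} {t u : A} {xs} → t ∈ xs → u ∈ xs → t ≢ u → 2 ≤ length xs
twoMembers⇒2≤length {xs = _ ∷ _ ∷ _} _          _          _   = s≤s (s≤s z≤n)
twoMembers⇒2≤length {xs = _ ∷ []}    (here refl) (here refl) t≢u = ⊥-elim (t≢u refl)

twoOf⇒∈ : ∀ {A : Set} {t u : A} {zs} → Unique zs → 2 ≤ length zs →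
          (∀ {s} → s ∈ zs → s ≡ t ⊎ s ≡ u) → t ∈ zs
twoOf⇒∈ {zs = _ ∷ []} _ (s≤s ()) _
twoOf⇒∈ {zs = s₁ ∷ s₂ ∷ _} ((s₁≢s₂ ∷ _) ∷ _) _ t-or-u
  with t-or-u (here refl) | t-or-u (there (here refl))
... | inj₁ s₁≡t | _         = subst (_∈ _) s₁≡t (here refl)
... | inj₂ _    | inj₁ s₂≡t = subst (_∈ _) s₂≡t (there (here refl))
... | inj₂ s₁≡u | inj₂ s₂≡u = ⊥-elim (s₁≢s₂ (trans s₁≡u (sym s₂≡u)))

head-least : ∀ {y x : ℕ} {ys} → All (y <_) ys → x ∈ y ∷ ys → y ≤ x
head-least _    (here refl) = ≤-refl
head-least y<ys (there x∈)  = <⇒≤ (All.lookup y<ys x∈)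

tail-⊆ : ∀ {x : ℕ} {xs ys} → All (x <_) xs → x ∷ xs ⊆ x ∷ ys → xs ⊆ ys
tail-⊆ x<xs sub z∈xs with sub (there z∈xs)
... | here refl  = ⊥-elim (<-irrefl refl (All.lookup x<xs z∈xs))
... | there z∈ys = z∈ys

strictlyIncreasing-≡ : ∀ {xs ys : List ℕ} → AllPairs _<_ xs → AllPairs _<_ ys →
                       xs ⊆ ys → ys ⊆ xs → xs ≡ ys
strictlyIncreasing-≡ []           []           _     _     = refl
strictlyIncreasing-≡ []           (_ ∷ _)      _     ys⊆xs with () ← ys⊆xs (here refl)
strictlyIncreasing-≡ (_ ∷ _)      []           xs⊆ys _     with () ← xs⊆ys (here refl)
strictlyIncreasing-≡ (x<xs ∷ xs↑) (y<ys ∷ ys↑) xs⊆ys ys⊆xs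
  with refl ← ≤-antisym (head-least y<ys (xs⊆ys (here refl))) (head-least x<xs (ys⊆xs (here refl)))
  = cong (_ ∷_) (strictlyIncreasing-≡ xs↑ ys↑ (tail-⊆ x<xs xs⊆ys) (tail-⊆ y<ys ys⊆xs))

partitionOf-swap : ∀ x y → partitionOf (x ∷ y ∷ []) ≡ partitionOf (y ∷ x ∷ [])
partitionOf-swap x y with y ≤? x | x ≤? y
... | yes y≤x | yes x≤y rewrite ≤-antisym y≤x x≤y = refl
... | yes _   | no _    = refl
... | no _    | yes _   = refl
... | no y≰x  | no x≰y with ≤-total x y
...   | inj₁ x≤y = ⊥-elim (x≰y x≤y)
...   | inj₂ y≤x = ⊥-elim (y≰x y≤x)

partitionOf-pair-inj : ∀ {x y u v} → partitionOf (x ∷ y ∷ []) ≡ partitionOf (u ∷ v ∷ []) →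
                       x ≡ u ⊎ x ≡ v
partitionOf-pair-inj {x} {y} {u} {v} e with y ≤? x | v ≤? u
... | yes _ | yes _ = inj₁ (∷-injectiveˡ e)
... | yes _ | no _  = inj₂ (∷-injectiveˡ e)
... | no _  | yes _ = inj₂ (∷-injectiveˡ (∷-injectiveʳ e))
... | no _  | no _  = inj₁ (∷-injectiveˡ (∷-injectiveʳ e))

cut : ℕ → ℕ → List ℕ
cut N t = t ∷ N ∸ t ∷ []

pairMonomial : ℕ → ℕ → List ℕ
pairMonomial N t = partitionOf (cut N t)

pairMonomial-complement : ∀ {N t} → t ≤ N → pairMonomial N (N ∸ t) ≡ pairMonomial N t
pairMonomial-complement {N} {t} t≤N = begin
  partitionOf (N ∸ t ∷ N ∸ (N ∸ t) ∷ []) ≡⟨ cong (λ u → partitionOf (N ∸ t ∷ u ∷ [])) (m∸[m∸n]≡n t≤N) ⟩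
  partitionOf (N ∸ t ∷ t ∷ [])           ≡⟨ partitionOf-swap (N ∸ t) t ⟩
  partitionOf (t ∷ N ∸ t ∷ [])           ∎

pairMonomial-inj : ∀ {N s t} → pairMonomial N s ≡ pairMonomial N t → s ≡ t ⊎ s ≡ N ∸ t
pairMonomial-inj = partitionOf-pair-inj

-- prefixSums a r: the sums of the proper non-empty prefixes of a ∷ r, i.e.
-- the positions of the cuts splitting a ∷ r into two parts.
prefixSums : ℕ → List ℕ → List ℕ
prefixSums a []      = []
prefixSums a (b ∷ r) = a ∷ prefixSums (a + b) r

prefixSums-≥ : ∀ a r → All (a ≤_) (prefixSums a r)
prefixSums-≥ a []      = []
prefixSums-≥ a (b ∷ r) = ≤-refl ∷ All.map (≤-trans (m≤m+n a b)) (prefixSums-≥ (a + b) r)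

prefixSums-≤ : ∀ a r → All (_≤ a + sum r) (prefixSums a r)
prefixSums-≤ a []      = []
prefixSums-≤ a (b ∷ r) =
  m≤m+n a (b + sum r) ∷ subst (λ n → All (_≤ n) (prefixSums (a + b) r)) (+-assoc a b (sum r)) (prefixSums-≤ (a + b) r)

prefixSums-increasing : ∀ a {r} → All (0 <_) r → AllPairs _<_ (prefixSums a r)
prefixSums-increasing a []                    = []
prefixSums-increasing a {b ∷ r} (0<b ∷ 0<r) =
  All.map (<-≤-trans (m<m+n a 0<b)) (prefixSums-≥ (a + b) r) ∷ prefixSums-increasing (a + b) 0<r

prefixSums-injective : ∀ a r a′ r′ → a + sum r ≡ a′ + sum r′ → prefixSums a r ≡ prefixSums a′ r′ →
                       a ∷ r ≡ a′ ∷ r′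
prefixSums-injective a [] a′ [] total _ = cong [_] (begin
  a      ≡⟨ sym (+-identityʳ a) ⟩
  a + 0  ≡⟨ total ⟩
  a′ + 0 ≡⟨ +-identityʳ a′ ⟩
  a′     ∎)
prefixSums-injective a (b ∷ r) a′ (b′ ∷ r′) total same with refl ← ∷-injectiveˡ same
  with a+b≡a+b′ , refl ← ∷-injective (prefixSums-injective (a + b) r (a + b′) r′
                                         (trans (+-assoc a b (sum r)) (trans total (sym (+-assoc a b′ (sum r′)))))
                                         (∷-injectiveʳ same))
  with refl ← +-cancelˡ-≡ a b b′ a+b≡a+b′ = refl

prefixSums-split⁻ : ∀ {a r t} → t ∈ prefixSums a r →
                    ∃[ xs ] ∃[ y ] ∃[ ys ] (r ≡ xs ++ y ∷ ys × t ≡ sum (a ∷ xs))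
prefixSums-split⁻ {a} {b ∷ r} (here refl) = [] , b , r , refl , sym (+-identityʳ a)
prefixSums-split⁻ {a} {b ∷ r} (there t∈) with xs , y , ys , refl , refl ← prefixSums-split⁻ t∈ =
  b ∷ xs , y , ys , refl , +-assoc a b (sum xs)

prefixSums-split⁺ : ∀ a xs y ys → sum (a ∷ xs) ∈ prefixSums a (xs ++ y ∷ ys)
prefixSums-split⁺ a []       y ys = here (+-identityʳ a)
prefixSums-split⁺ a (x ∷ xs) y ys =
  there (subst (_∈ prefixSums (a + x) (xs ++ y ∷ ys)) (+-assoc a x (sum xs)) (prefixSums-split⁺ (a + x) xs y ys))

prefixSums-reverse : ∀ {a r c s t} → reverse (a ∷ r) ≡ c ∷ s → t ∈ prefixSums a r →
                     (a + sum r) ∸ t ∈ prefixSums c s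
prefixSums-reverse {a} rev t∈
  with xs , y , ys , refl , refl ← prefixSums-split⁻ t∈
  with z , zs , rev-y ← reverse-nonEmpty y ys
  with w , ws , rev-a ← reverse-nonEmpty a xs
  with refl ← trans (sym rev) (trans (reverse-++ (a ∷ xs) (y ∷ ys)) (cong₂ _++_ rev-y rev-a))
  = subst (_∈ prefixSums z (zs ++ w ∷ ws)) complement (prefixSums-split⁺ z zs w ws)
  where
  complement : sum (z ∷ zs) ≡ sum ((a ∷ xs) ++ y ∷ ys) ∸ sum (a ∷ xs)
  complement = begin
    sum (z ∷ zs)                                   ≡⟨ cong sum (sym rev-y) ⟩
    sum (reverse (y ∷ ys))                         ≡⟨ sum-↭ (↭-reverse (y ∷ ys)) ⟩
    sum (y ∷ ys)                                   ≡⟨ sym (m+n∸m≡n (sum (a ∷ xs)) (sum (y ∷ ys))) ⟩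
    sum (a ∷ xs) + sum (y ∷ ys) ∸ sum (a ∷ xs)     ≡⟨ cong (_∸ sum (a ∷ xs)) (sym (sum-++ (a ∷ xs) (y ∷ ys))) ⟩
    sum ((a ∷ xs) ++ y ∷ ys) ∸ sum (a ∷ xs)        ∎

withParts : ℕ → List (List ℕ) → List (List ℕ)
withParts k = filter (λ c → length c ≟ k)

length-insertDec : ∀ x ys → length (insertDec x ys) ≡ suc (length ys)
length-insertDec x []       = refl
length-insertDec x (y ∷ ys) with y ≤? x
... | yes _ = refl
... | no _  = cong suc (length-insertDec x ys)

length-partitionOf : ∀ xs → length (partitionOf xs) ≡ length xs
length-partitionOf []       = refl
length-partitionOf (x ∷ xs) = trans (length-insertDec x (partitionOf xs)) (cong suc (length-partitionOf xs))

withParts-partitionOf : ∀ k cs → withParts k (map partitionOf cs) ≡ map partitionOf (withParts k cs)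
withParts-partitionOf k []       = refl
withParts-partitionOf k (c ∷ cs) rewrite length-partitionOf c with does (length c ≟ k)
... | true  = cong (partitionOf c ∷_) (withParts-partitionOf k cs)
... | false = withParts-partitionOf k cs

withParts-zero-cons : ∀ a cs → withParts 0 (map (a ∷_) cs) ≡ []
withParts-zero-cons a []       = refl
withParts-zero-cons a (c ∷ cs) = withParts-zero-cons a cs

withParts-suc-cons : ∀ a k cs → withParts (suc k) (map (a ∷_) cs) ≡ map (a ∷_) (withParts k cs)
withParts-suc-cons a k []       = refl
withParts-suc-cons a k (c ∷ cs) with does (length c ≟ k)
... | true  = cong ((a ∷ c) ∷_) (withParts-suc-cons a k cs)
... | false = withParts-suc-cons a k cs

withParts-coarseningsFrom : ∀ k a b r →
  withParts k (coarseningsFrom a (b ∷ r)) ≡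
  withParts k (map (a ∷_) (coarseningsFrom b r)) ++ withParts k (coarseningsFrom (a + b) r)
withParts-coarseningsFrom k a b r = filter-++ (λ c → length c ≟ k) (map (a ∷_) (coarseningsFrom b r)) _

coarsenings-noPart : ∀ a r → withParts 0 (coarseningsFrom a r) ≡ []
coarsenings-noPart a []      = refl
coarsenings-noPart a (b ∷ r) = begin
  withParts 0 (coarseningsFrom a (b ∷ r))                    ≡⟨ withParts-coarseningsFrom 0 a b r ⟩
  withParts 0 (map (a ∷_) (coarseningsFrom b r)) ++
    withParts 0 (coarseningsFrom (a + b) r)                  ≡⟨ cong₂ _++_ (withParts-zero-cons a (coarseningsFrom b r)) (coarsenings-noPart (a + b) r) ⟩
  []                                                         ∎

coarsenings-onePart : ∀ a r → withParts 1 (coarseningsFrom a r) ≡ [ [ a + sum r ] ]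
coarsenings-onePart a []      = cong (λ n → [ [ n ] ]) (sym (+-identityʳ a))
coarsenings-onePart a (b ∷ r) = begin
  withParts 1 (coarseningsFrom a (b ∷ r))                    ≡⟨ withParts-coarseningsFrom 1 a b r ⟩
  withParts 1 (map (a ∷_) (coarseningsFrom b r)) ++
    withParts 1 (coarseningsFrom (a + b) r)                  ≡⟨ cong₂ _++_ (withParts-suc-cons a 0 (coarseningsFrom b r)) (coarsenings-onePart (a + b) r) ⟩
  map (a ∷_) (withParts 0 (coarseningsFrom b r)) ++
    [ [ a + b + sum r ] ]                                    ≡⟨ cong₂ (λ cs n → map (a ∷_) cs ++ [ [ n ] ]) (coarsenings-noPart b r) (+-assoc a b (sum r)) ⟩
  [ [ a + (b + sum r) ] ]                                    ∎

coarsenings-twoParts : ∀ a r → withParts 2 (coarseningsFrom a r) ≡ map (cut (a + sum r)) (prefixSums a r)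
coarsenings-twoParts a []      = refl
coarsenings-twoParts a (b ∷ r) = begin
  withParts 2 (coarseningsFrom a (b ∷ r))                    ≡⟨ withParts-coarseningsFrom 2 a b r ⟩
  withParts 2 (map (a ∷_) (coarseningsFrom b r)) ++
    withParts 2 (coarseningsFrom (a + b) r)                  ≡⟨ cong₂ _++_ (withParts-suc-cons a 1 (coarseningsFrom b r)) (coarsenings-twoParts (a + b) r) ⟩
  map (a ∷_) (withParts 1 (coarseningsFrom b r)) ++
    map (cut (a + b + sum r)) (prefixSums (a + b) r)         ≡⟨ cong₂ (λ cs N → map (a ∷_) cs ++ map (cut N) (prefixSums (a + b) r))
                                                                       (coarsenings-onePart b r) (+-assoc a b (sum r)) ⟩
  (a ∷ b + sum r ∷ []) ∷ map (cut N) (prefixSums (a + b) r) ≡⟨ cong (λ n → (a ∷ n ∷ []) ∷ map (cut N) (prefixSums (a + b) r))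
                                                                    (sym (m+n∸m≡n a (b + sum r))) ⟩
  map (cut N) (prefixSums a (b ∷ r))                         ∎
  where N = a + (b + sum r)

L-onePart : ∀ a r → withParts 1 (L (a ∷ r)) ≡ [ [ a + sum r ] ]
L-onePart a r = trans (withParts-partitionOf 1 (coarseningsFrom a r))
                      (cong (map partitionOf) (coarsenings-onePart a r))

L-twoParts : ∀ a r → withParts 2 (L (a ∷ r)) ≡ map (pairMonomial (a + sum r)) (prefixSums a r)
L-twoParts a r = begin
  withParts 2 (map partitionOf (coarseningsFrom a r))         ≡⟨ withParts-partitionOf 2 (coarseningsFrom a r) ⟩
  map partitionOf (withParts 2 (coarseningsFrom a r))         ≡⟨ cong (map partitionOf) (coarsenings-twoParts a r) ⟩
  map partitionOf (map (cut (a + sum r)) (prefixSums a r))    ≡⟨ sym (map-∘ (prefixSums a r)) ⟩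
  map (pairMonomial (a + sum r)) (prefixSums a r)             ∎

_≟ₗ_ : DecidableEquality (List ℕ)
_≟ₗ_ = ≡-dec _≟_

fibre : (ℕ → List ℕ) → List ℕ → List ℕ → List ℕ
fibre f p = filter (λ s → f s ≟ₗ p)

fibre-length-↭ : ∀ f p {X Y} → map f X ↭ map f Y → length (fibre f p X) ≡ length (fibre f p Y)
fibre-length-↭ f p {X} {Y} fX↭fY = begin
  length (fibre f p X)               ≡⟨ sym (length-map f (fibre f p X)) ⟩
  length (map f (fibre f p X))       ≡⟨ cong length (sym (filter-map (_≟ₗ p) f X)) ⟩
  length (filter (_≟ₗ p) (map f X))  ≡⟨ ↭-length (filter-↭ (_≟ₗ p) fX↭fY) ⟩
  length (filter (_≟ₗ p) (map f Y))  ≡⟨ cong length (filter-map (_≟ₗ p) f Y) ⟩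
  length (map f (fibre f p Y))       ≡⟨ length-map f (fibre f p Y) ⟩
  length (fibre f p Y)               ∎

pairs-⊆ : ∀ {N X Y} → (∀ {t} → t ∈ Y → N ∸ t ∈ Y) →
          map (pairMonomial N) X ↭ map (pairMonomial N) Y → X ⊆ Y
pairs-⊆ {N} symY X↭Y t∈X
  with s , s∈Y , e ← ∈-map⁻ (pairMonomial N) (∈-resp-↭ X↭Y (∈-map⁺ (pairMonomial N) t∈X))
  with pairMonomial-inj e
... | inj₁ refl = s∈Y
... | inj₂ refl = symY s∈Y

-- ... and, if moreover X has no repetitions, every element t of Y lies in X:
-- for t = N - t the monomial of t occurs in X, otherwise its fibre in Y
-- contains both t and N - t, so the fibre in X has two distinct elements.
pairs-⊇ : ∀ {N X Y} → Unique X → (∀ {t} → t ∈ Y → t ≤ N) → (∀ {t} → t ∈ Y → N ∸ t ∈ Y) →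
          map (pairMonomial N) X ↭ map (pairMonomial N) Y → Y ⊆ X
pairs-⊇ {N} {X} {Y} uniqueX boundY symY X↭Y {t} t∈Y with t ≟ N ∸ t
... | yes t≡N∸t
  with s , s∈X , e ← ∈-map⁻ (pairMonomial N) (∈-resp-↭ (↭-sym X↭Y) (∈-map⁺ (pairMonomial N) t∈Y))
  with pairMonomial-inj (sym e)
... | inj₁ s≡t   = subst (_∈ X) s≡t s∈X
... | inj₂ s≡N∸t = subst (_∈ X) (trans s≡N∸t (sym t≡N∸t)) s∈X
pairs-⊇ {N} {X} {Y} uniqueX boundY symY X↭Y {t} t∈Y | no t≢N∸t =
  proj₁ (∈-filter⁻ inFibre? {xs = X} (twoOf⇒∈ (Unique.filter⁺ inFibre? uniqueX) twoInX only))
  where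
  p = pairMonomial N t
  inFibre? : Decidable (λ s → pairMonomial N s ≡ p)
  inFibre? s = pairMonomial N s ≟ₗ p
  twoInY : 2 ≤ length (fibre (pairMonomial N) p Y)
  twoInY = twoMembers⇒2≤length (∈-filter⁺ inFibre? t∈Y refl)
                               (∈-filter⁺ inFibre? (symY t∈Y) (pairMonomial-complement (boundY t∈Y)))
                               t≢N∸t
  twoInX : 2 ≤ length (fibre (pairMonomial N) p X)
  twoInX = subst (2 ≤_) (sym (fibre-length-↭ (pairMonomial N) p X↭Y)) twoInY
  only : ∀ {s} → s ∈ fibre (pairMonomial N) p X → s ≡ t ⊎ s ≡ N ∸ t
  only s∈ = pairMonomial-inj (proj₂ (∈-filter⁻ inFibre? {xs = X} s∈))

≡L-palindrome⇒≡ : ∀ {α β} → IsComposition α → IsComposition β → IsPalindrome β → α ≡L β → α ≡ β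
≡L-palindrome⇒≡ {[]}    {[]}    _ _ _ _ = refl
≡L-palindrome⇒≡ {[]}    {b ∷ q} _ _ _ α≡β
  with () ← ↭-singleton-inv (subst ([] ↭_) (L-onePart b q) (filter-↭ (λ c → length c ≟ 1) α≡β))
≡L-palindrome⇒≡ {a ∷ r} {[]}    _ _ _ α≡β
  with () ← ↭-empty-inv (subst (_↭ []) (L-onePart a r) (filter-↭ (λ c → length c ≟ 1) α≡β))
≡L-palindrome⇒≡ {a ∷ r} {b ∷ q} (_ ∷ 0<r) (_ ∷ 0<q) palindrome α≡β =
  prefixSums-injective a r b q total
    (strictlyIncreasing-≡ (prefixSums-increasing a 0<r) (prefixSums-increasing b 0<q)
      (pairs-⊆ symY pairs)
      (pairs-⊇ (AllPairs.map <⇒≢ (prefixSums-increasing a 0<r)) (All.lookup (prefixSums-≤ b q)) symY pairs))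
  where
  N = b + sum q
  total : a + sum r ≡ N
  total = ∷-injectiveˡ (∷-injectiveˡ (↭-singleton-inv
            (subst₂ _↭_ (L-onePart a r) (L-onePart b q) (filter-↭ (λ c → length c ≟ 1) α≡β))))
  pairs : map (pairMonomial N) (prefixSums a r) ↭ map (pairMonomial N) (prefixSums b q)
  pairs = subst₂ _↭_ (trans (L-twoParts a r) (cong (λ n → map (pairMonomial n) (prefixSums a r)) total))
                     (L-twoParts b q) (filter-↭ (λ c → length c ≟ 2) α≡β)
  symY : ∀ {t} → t ∈ prefixSums b q → N ∸ t ∈ prefixSums b q
  symY = prefixSums-reverse palindrome

proposition3p6 : (β : List ℕ) → IsComposition β → IsPalindrome β → LUnique β
proposition3p6 β compβ palindrome α compα = mk⇔ (inj₁ ∘ ≡L-palindrome⇒≡ compα compβ palindrome) from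
  where
  from : α ≡ β ⊎ α ≡ reverse β → α ≡L β
  from (inj₁ refl) = ↭-refl
  from (inj₂ refl) = subst (λ γ → L (reverse β) ↭ L γ) palindrome ↭-refl
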